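{- Let $w\ge 4$, $h=\lfloor w/2\rfloor$. Let $m,n\in A_w$ with $p(m)=(\alpha^1,\dots,\alpha^h)$, all $\alpha^i\ge 1$, $\alpha^{h-1}+\alpha^h\ge 10$, and $p(n)=(\alpha^1,\dots,\alpha^{h-1},10-\alpha^h)$. Then $K^2(m)=K^2(n)$.
   Context: A $w$-digit number is a string of $w$ decimal digits (leading zeros allowed); $A_w$ is the set of those whose digits are not all identical. For a $w$-digit number $n$, $O_d(n)=x_1\dots x_w$ is obtained by sorting its digits in non-increasing order and $O_u(n)=x_w\dots x_1$ by sorting them in non-decreasing order; the Kaprekar map is $K(n)=O_d(n)-O_u(n)$, written as a $w$-digit string with leading zeros, and $K^2=K\circ K$. The parameters of a $w$-digit number $n$ are $p(n)=(\alpha^1,\dots,\alpha^h)$, $\alpha^i=x_i-x_{w-i+1}$ where $x_1\ge\dots\ge x_w$ are its sorted digits. -}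

module Defs where

open import Data.Nat using (ℕ; zero; suc; _+_; _*_; _∸_; ⌊_/2⌋)
open import Data.Nat.Properties using (≤-decTotalOrder)
open import Data.Nat.DivMod using (_/_; _mod_)
open import Data.Fin using (Fin; toℕ)
open import Data.Vec using (Vec; []; _∷_; _∷ʳ_; lookup; toList)
open import Data.List using (List; foldl; reverse; take; zipWith; map)
open import Relation.Binary.PropositionalEquality using (_≡_)
open import Relation.Nullary using (¬_)
import Data.List.Sort.InsertionSort as ISort

-- A w-digit number: a string of w decimal digits, most significant first
-- (leading zeros allowed).
Digits : ℕ → Set
Digits w = Vec (Fin 10) w

valueL : List ℕ → ℕ
valueL = foldl (λ acc d → 10 * acc + d) 0

digitsℕ : ∀ {w} → Digits w → List ℕ
digitsℕ d = map toℕ (toList d)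

sortedUp : ∀ {w} → Digits w → List ℕ
sortedUp d = ISort.sort ≤-decTotalOrder (digitsℕ d)

sortedDown : ∀ {w} → Digits w → List ℕ
sortedDown d = reverse (sortedUp d)

Od : ∀ {w} → Digits w → ℕ
Od d = valueL (sortedDown d)

Ou : ∀ {w} → Digits w → ℕ
Ou d = valueL (sortedUp d)

-- write a natural number as a w-digit string (leading zeros; reduced mod 10^w)
toDigits : (w : ℕ) → ℕ → Digits w
toDigits zero    v = []
toDigits (suc w) v = toDigits w (v / 10) ∷ʳ (v mod 10)

K : ∀ {w} → Digits w → Digits w
K {w} d = toDigits w (Od d ∸ Ou d)

K² : ∀ {w} → Digits w → Digits w
K² d = K (K d)

AllSame : ∀ {w} → Digits w → Set
AllSame d = ∀ i j → lookup d i ≡ lookup d j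

InA : ∀ {w} → Digits w → Set
InA d = ¬ AllSame d

-- parameters p(n) = (α¹,…,α^h), h = ⌊w/2⌋, αⁱ = xᵢ − x_{w−i+1}
params : ∀ {w} → Digits w → List ℕ
params {w} d =
  zipWith _∸_ (take ⌊ w /2⌋ (sortedDown d)) (take ⌊ w /2⌋ (sortedUp d))

-- When every parameter is positive, K(n) depends only on p(n): its digits are
-- α¹ … αʰ⁻¹ (αʰ − 1) 9 … 9 (9 − αʰ) … (9 − α²) (10 − α¹), since O_d(n) − O_u(n)
-- is the number α¹…αʰ shifted by w − h places minus the number αʰ…α¹.
-- Replacing αʰ by 10 − αʰ merely exchanges the digits αʰ − 1 and 9 − αʰ, so
-- K(m) and K(n) are permutations of each other, and K sees only the multiset of digits.
module Submission where

open import Defs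
open import Data.Nat using (ℕ; _+_; _∸_; _≤_)
open import Data.List using (List; _∷_; []; _++_)
open import Data.List.Relation.Unary.All using (All)
open import Relation.Binary.PropositionalEquality using (_≡_)

open import Data.Nat using (zero; suc; _*_; _^_; _<_; _⊓_; z≤n; s≤s; ⌊_/2⌋; ⌈_/2⌉)
open import Data.Nat.Properties using (+-identityʳ; *-identityʳ; *-identityˡ; +-assoc; +-comm; suc-injective; ≤-refl; ≤-trans; ≤-pred; <⇒≤; m≤n⇒m≤1+n; m∸n≤m; m∸n+n≡m; m+n∸n≡m; m∸[m∸n]≡n; ∸-+-assoc; [m+n]∸[m+o]≡n∸o; m<n⇒0<n∸m; m∸n≢0⇒n<m; n>0⇒n≢0; ⊓-idem; m≤n⇒m⊓n≡m; ⌊n/2⌋-mono; ⌊n/2⌋≤n; ⌊n/2⌋≤⌈n/2⌉; ⌊n/2⌋+⌈n/2⌉≡n; ≤-decTotalOrder; ≤-totalOrder)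
open import Data.Nat.DivMod using (_/_; _%_; _mod_; /-congˡ; +-distrib-/-∣ˡ; m*n/n≡m; m<n⇒m/n≡0; [m+kn]%n≡m%n; m<n⇒m%n≡m; m%n<n; %-congˡ)
open import Data.Nat.Divisibility using (n∣m*n)
open import Data.Nat.Tactic.RingSolver using (solve-∀)
open import Data.Fin using (toℕ)
open import Data.Fin.Properties using (toℕ<n; toℕ-fromℕ<)
open import Data.Vec using (toList; _∷ʳ_)
open import Data.Vec.Properties using (toList-∷ʳ; length-toList)
open import Data.List using (foldl; foldr; length; reverse; replicate; zipWith; take; map; [_])
open import Data.List.Properties using (foldl-++; ++-assoc; reverse-++; reverse-involutive; reverse-foldl; unfold-reverse; length-++; length-reverse; length-replicate; length-map; length-take; length-zipWith; map-++)
open import Data.List.Relation.Unary.All using ([]; _∷_; universal)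
open import Data.List.Relation.Unary.All.Properties using (++⁺; ++⁻; map⁺; replicate⁺; take⁺; zipWith⁺)
open import Data.List.Relation.Binary.Pointwise using (Pointwise; []; _∷_; Pointwise-length; Pointwise-≡⇒≡)
import Data.List.Relation.Binary.Pointwise as Pointwise
open import Data.List.Relation.Binary.Permutation.Propositional using (_↭_; prep; swap; ↭-refl; ↭-sym; ↭-trans; ↭⇒↭ₛ; module PermutationReasoning)
open import Data.List.Relation.Binary.Permutation.Propositional.Properties using (shift; ++⁺ˡ; All-resp-↭; ↭-reverse; ↭-length)
open import Data.List.Relation.Unary.Sorted.TotalOrder.Properties using (↗↭↗⇒≋)
open import Data.List.Sort.InsertionSort.Properties ≤-decTotalOrder using (sort-↭; sort-↗)
open import Data.Product using (_×_; _,_; proj₂; ∃₂)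
open import Function using (flip; _∘_)
open import Relation.Binary.PropositionalEquality using (refl; sym; trans; cong; cong₂; subst; module ≡-Reasoning)

All-reverse : ∀ {P : ℕ → Set} {xs} → All P xs → All P (reverse xs)
All-reverse {xs = xs} = All-resp-↭ (↭-sym (↭-reverse xs))

reverse-++-++ : ∀ {A : Set} (xs ys zs : List A) → reverse (xs ++ ys ++ zs) ≡ reverse zs ++ reverse ys ++ reverse xs
reverse-++-++ xs ys zs = begin
  reverse (xs ++ ys ++ zs)                 ≡⟨ reverse-++ xs (ys ++ zs) ⟩
  reverse (ys ++ zs) ++ reverse xs         ≡⟨ cong (_++ reverse xs) (reverse-++ ys zs) ⟩
  (reverse zs ++ reverse ys) ++ reverse xs ≡⟨ ++-assoc (reverse zs) (reverse ys) (reverse xs) ⟩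
  reverse zs ++ reverse ys ++ reverse xs   ∎
  where open ≡-Reasoning

take-++-length : ∀ {A : Set} (xs ys : List A) {n} → length xs ≡ n → take n (xs ++ ys) ≡ xs
take-++-length []       ys refl = refl
take-++-length (x ∷ xs) ys refl = cong (x ∷_) (take-++-length xs ys refl)

splitAt-length : ∀ {A : Set} m {n} (xs : List A) → length xs ≡ m + n →
  ∃₂ λ ys zs → xs ≡ ys ++ zs × length ys ≡ m × length zs ≡ n
splitAt-length zero    xs       eq = [] , xs , refl , refl , eq
splitAt-length (suc m) (x ∷ xs) eq with splitAt-length m xs (suc-injective eq)
... | ys , zs , refl , refl , refl = x ∷ ys , zs , refl , refl , refl

reverse-length≤1 : ∀ {A : Set} (xs : List A) → length xs ≤ 1 → reverse xs ≡ xs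
reverse-length≤1 []          _               = refl
reverse-length≤1 (x ∷ [])    _               = refl
reverse-length≤1 (x ∷ y ∷ _) (s≤s ())

↭-exchange : ∀ (x y : ℕ) xs ys → x ∷ xs ++ y ∷ ys ↭ y ∷ xs ++ x ∷ ys
↭-exchange x y xs ys = begin
  x ∷ xs ++ y ∷ ys   ↭⟨ shift x xs (y ∷ ys) ⟨
  xs ++ x ∷ y ∷ ys   ↭⟨ ++⁺ˡ xs (swap x y ↭-refl) ⟩
  xs ++ y ∷ x ∷ ys   ↭⟨ shift y xs (x ∷ ys) ⟩
  y ∷ xs ++ x ∷ ys   ∎
  where open PermutationReasoning

appendDigit : ℕ → ℕ → ℕ
appendDigit acc d = 10 * acc + d

foldl-appendDigit : ∀ a xs → foldl appendDigit a xs ≡ a * 10 ^ length xs + valueL xs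
foldl-appendDigit a []       = sym (trans (+-identityʳ (a * 1)) (*-identityʳ a))
foldl-appendDigit a (x ∷ xs) = begin
  foldl appendDigit (10 * a + x) xs            ≡⟨ foldl-appendDigit (10 * a + x) xs ⟩
  (10 * a + x) * 10 ^ length xs + valueL xs     ≡⟨ shift-left a x (10 ^ length xs) (valueL xs) ⟩
  a * 10 ^ suc (length xs) + (x * 10 ^ length xs + valueL xs)
    ≡⟨ cong (a * 10 ^ suc (length xs) +_) (foldl-appendDigit x xs) ⟨
  a * 10 ^ suc (length xs) + valueL (x ∷ xs)  ∎
  where
  open ≡-Reasoning
  shift-left : ∀ a x p v → (10 * a + x) * p + v ≡ a * (10 * p) + (x * p + v)
  shift-left = solve-∀

valueL-++ : ∀ xs ys → valueL (xs ++ ys) ≡ valueL xs * 10 ^ length ys + valueL ys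
valueL-++ xs ys = trans (foldl-++ appendDigit 0 xs ys) (foldl-appendDigit (valueL xs) ys)

valueL-++-++ : ∀ xs ys zs →
  valueL (xs ++ ys ++ zs) ≡ (valueL xs * 10 ^ length ys + valueL ys) * 10 ^ length zs + valueL zs
valueL-++-++ xs ys zs = begin
  valueL (xs ++ ys ++ zs)                         ≡⟨ cong valueL (++-assoc xs ys zs) ⟨
  valueL ((xs ++ ys) ++ zs)                       ≡⟨ valueL-++ (xs ++ ys) zs ⟩
  valueL (xs ++ ys) * 10 ^ length zs + valueL zs  ≡⟨ cong (λ v → v * 10 ^ length zs + valueL zs) (valueL-++ xs ys) ⟩
  (valueL xs * 10 ^ length ys + valueL ys) * 10 ^ length zs + valueL zs ∎
  where open ≡-Reasoning

appendDigit-∸ : ∀ a b {x y} → y ≤ x → appendDigit a (x ∸ y) + appendDigit b y ≡ appendDigit (a + b) x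
appendDigit-∸ a b {x} {y} y≤x = begin
  10 * a + (x ∸ y) + (10 * b + y)  ≡⟨ regroup a b (x ∸ y) y ⟩
  10 * (a + b) + (x ∸ y + y)       ≡⟨ cong (10 * (a + b) +_) (m∸n+n≡m y≤x) ⟩
  10 * (a + b) + x                 ∎
  where
  open ≡-Reasoning
  regroup : ∀ a b t y → 10 * a + t + (10 * b + y) ≡ 10 * (a + b) + (t + y)
  regroup = solve-∀

foldl-zipWith-∸ : ∀ a b {xs ys} → Pointwise _≤_ ys xs →
  foldl appendDigit a (zipWith _∸_ xs ys) + foldl appendDigit b ys ≡ foldl appendDigit (a + b) xs
foldl-zipWith-∸ a b []           = refl
foldl-zipWith-∸ a b {x ∷ xs} {y ∷ ys} (y≤x ∷ ys≤xs) =
  trans (foldl-zipWith-∸ (appendDigit a (x ∸ y)) (appendDigit b y) ys≤xs)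
        (cong (λ c → foldl appendDigit c xs) (appendDigit-∸ a b y≤x))

valueL-zipWith-∸ : ∀ {xs ys} → Pointwise _≤_ ys xs → valueL (zipWith _∸_ xs ys) + valueL ys ≡ valueL xs
valueL-zipWith-∸ = foldl-zipWith-∸ 0 0

valueL-reverse-zipWith-∸ : ∀ {xs ys} → Pointwise _≤_ ys xs →
  valueL (reverse (zipWith _∸_ xs ys)) + valueL (reverse ys) ≡ valueL (reverse xs)
valueL-reverse-zipWith-∸ {xs} {ys} ys≤xs = begin
  valueL (reverse (zipWith _∸_ xs ys)) + valueL (reverse ys)
    ≡⟨ cong₂ _+_ (reverse-foldl appendDigit 0 (zipWith _∸_ xs ys)) (reverse-foldl appendDigit 0 ys) ⟩
  foldr (flip appendDigit) 0 (zipWith _∸_ xs ys) + foldr (flip appendDigit) 0 ys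
    ≡⟨ foldr-zipWith-∸ ys≤xs ⟩
  foldr (flip appendDigit) 0 xs
    ≡⟨ reverse-foldl appendDigit 0 xs ⟨
  valueL (reverse xs) ∎
  where
  open ≡-Reasoning
  foldr-zipWith-∸ : ∀ {xs ys} → Pointwise _≤_ ys xs →
    foldr (flip appendDigit) 0 (zipWith _∸_ xs ys) + foldr (flip appendDigit) 0 ys ≡ foldr (flip appendDigit) 0 xs
  foldr-zipWith-∸ []            = refl
  foldr-zipWith-∸ {x ∷ xs} {y ∷ ys} (y≤x ∷ ys≤xs) =
    trans (appendDigit-∸ (foldr (flip appendDigit) 0 (zipWith _∸_ xs ys)) (foldr (flip appendDigit) 0 ys) y≤x)
          (cong (λ c → appendDigit c x) (foldr-zipWith-∸ ys≤xs))

[m*10+d]/10≡m : ∀ m {d} → d < 10 → (m * 10 + d) / 10 ≡ m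
[m*10+d]/10≡m m {d} d<10 = begin
  (m * 10 + d) / 10     ≡⟨ +-distrib-/-∣ˡ d (n∣m*n m) ⟩
  m * 10 / 10 + d / 10  ≡⟨ cong₂ _+_ (m*n/n≡m m 10) (m<n⇒m/n≡0 d<10) ⟩
  m + 0                 ≡⟨ +-identityʳ m ⟩
  m                     ∎
  where open ≡-Reasoning

[m*10+d]%10≡d : ∀ m {d} → d < 10 → (m * 10 + d) % 10 ≡ d
[m*10+d]%10≡d m {d} d<10 = begin
  (m * 10 + d) % 10  ≡⟨ %-congˡ (+-comm (m * 10) d) ⟩
  (d + m * 10) % 10  ≡⟨ [m+kn]%n≡m%n d m 10 ⟩
  d % 10             ≡⟨ m<n⇒m%n≡m d<10 ⟩
  d                  ∎
  where open ≡-Reasoning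

toDigits-valueL-reverse : ∀ ys → All (_< 10) ys → digitsℕ (toDigits (length ys) (valueL (reverse ys))) ≡ reverse ys
toDigits-valueL-reverse []       []             = refl
toDigits-valueL-reverse (y ∷ ys) (y<10 ∷ ys<10) = begin
  map toℕ (toList (toDigits n (v / 10) ∷ʳ (v mod 10)))
    ≡⟨ cong (map toℕ) (toList-∷ʳ (v mod 10) (toDigits n (v / 10))) ⟩
  map toℕ (toList (toDigits n (v / 10)) ++ [ v mod 10 ])
    ≡⟨ map-++ toℕ (toList (toDigits n (v / 10))) [ v mod 10 ] ⟩
  digitsℕ (toDigits n (v / 10)) ++ [ toℕ (v mod 10) ]
    ≡⟨ cong₂ (λ u d → digitsℕ (toDigits n u) ++ [ d ]) quotient remainder ⟩
  digitsℕ (toDigits n (valueL (reverse ys))) ++ [ y ]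
    ≡⟨ cong (_++ [ y ]) (toDigits-valueL-reverse ys ys<10) ⟩
  reverse ys ++ [ y ]
    ≡⟨ unfold-reverse y ys ⟨
  reverse (y ∷ ys) ∎
  where
  open ≡-Reasoning
  n = length ys
  v = valueL (reverse (y ∷ ys))
  v≡ : v ≡ valueL (reverse ys) * 10 + y
  v≡ = trans (cong valueL (unfold-reverse y ys)) (valueL-++ (reverse ys) [ y ])
  quotient : v / 10 ≡ valueL (reverse ys)
  quotient = trans (/-congˡ v≡) ([m*10+d]/10≡m (valueL (reverse ys)) y<10)
  remainder : toℕ (v mod 10) ≡ y
  remainder = trans (toℕ-fromℕ< (m%n<n v 10)) (trans (%-congˡ v≡) ([m*10+d]%10≡d (valueL (reverse ys)) y<10))

toDigits-valueL : ∀ {w} xs → length xs ≡ w → All (_< 10) xs → digitsℕ (toDigits w (valueL xs)) ≡ xs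
toDigits-valueL xs refl xs<10 = begin
  digitsℕ (toDigits (length xs) (valueL xs))
    ≡⟨ cong₂ (λ n ys → digitsℕ (toDigits n (valueL ys))) (length-reverse xs) (reverse-involutive xs) ⟨
  digitsℕ (toDigits (length (reverse xs)) (valueL (reverse (reverse xs))))
    ≡⟨ toDigits-valueL-reverse (reverse xs) (All-reverse xs<10) ⟩
  reverse (reverse xs)
    ≡⟨ reverse-involutive xs ⟩
  xs ∎
  where open ≡-Reasoning

decrementLast : List ℕ → List ℕ
decrementLast []           = []
decrementLast (x ∷ [])     = [ x ∸ 1 ]
decrementLast (x ∷ y ∷ ys) = x ∷ decrementLast (y ∷ ys)

tensComplement : List ℕ → List ℕ
tensComplement []           = []
tensComplement (x ∷ [])     = [ 10 ∸ x ]
tensComplement (x ∷ y ∷ ys) = (9 ∸ x) ∷ tensComplement (y ∷ ys)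

-- For αs = p(n) with every αⁱ ≥ 1 and r = w − 2h, the digit string of K(n).
kaprekarDigits : ℕ → List ℕ → List ℕ
kaprekarDigits r αs = decrementLast αs ++ replicate r 9 ++ tensComplement (reverse αs)

length-decrementLast : ∀ xs → length (decrementLast xs) ≡ length xs
length-decrementLast []           = refl
length-decrementLast (x ∷ [])     = refl
length-decrementLast (x ∷ y ∷ ys) = cong suc (length-decrementLast (y ∷ ys))

length-tensComplement : ∀ xs → length (tensComplement xs) ≡ length xs
length-tensComplement []           = refl
length-tensComplement (x ∷ [])     = refl
length-tensComplement (x ∷ y ∷ ys) = cong suc (length-tensComplement (y ∷ ys))

length-kaprekarDigits : ∀ r αs → length (kaprekarDigits r αs) ≡ length αs + (r + length αs)
length-kaprekarDigits r αs = begin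
  length (decrementLast αs ++ replicate r 9 ++ tensComplement (reverse αs))
    ≡⟨ length-++ (decrementLast αs) ⟩
  length (decrementLast αs) + length (replicate r 9 ++ tensComplement (reverse αs))
    ≡⟨ cong₂ _+_ (length-decrementLast αs) (length-++ (replicate r 9)) ⟩
  length αs + (length (replicate r 9) + length (tensComplement (reverse αs)))
    ≡⟨ cong₂ (λ i j → length αs + (i + j)) (length-replicate r) (trans (length-tensComplement (reverse αs)) (length-reverse αs)) ⟩
  length αs + (r + length αs) ∎
  where open ≡-Reasoning

decrementLast-++ : ∀ xs y ys → decrementLast (xs ++ y ∷ ys) ≡ xs ++ decrementLast (y ∷ ys)
decrementLast-++ []            y ys = refl
decrementLast-++ (x ∷ [])      y ys = refl
decrementLast-++ (x ∷ x′ ∷ xs) y ys = cong (x ∷_) (decrementLast-++ (x′ ∷ xs) y ys)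

foldl-decrementLast : ∀ a {xs} → 0 < length xs → All (1 ≤_) xs →
  foldl appendDigit a (decrementLast xs) + 1 ≡ foldl appendDigit a xs
foldl-decrementLast a {x ∷ []}     _ (1≤x ∷ []) = trans (+-assoc (10 * a) (x ∸ 1) 1) (cong (10 * a +_) (m∸n+n≡m 1≤x))
foldl-decrementLast a {x ∷ y ∷ ys} _ (_ ∷ pos)  = foldl-decrementLast (10 * a + x) (s≤s z≤n) pos

nine-carry : ∀ c p → (10 * c + 9 + 1) * p ≡ (c + 1) * (10 * p)
nine-carry = solve-∀

foldl-nines : ∀ a r → foldl appendDigit a (replicate r 9) + 1 ≡ (a + 1) * 10 ^ r
foldl-nines a zero    = sym (*-identityʳ (a + 1))
foldl-nines a (suc r) = trans (foldl-nines (10 * a + 9) r) (nine-carry a (10 ^ r))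

foldl-tensComplement : ∀ a b {xs} → 0 < length xs → All (_≤ 9) xs →
  foldl appendDigit a (tensComplement xs) + foldl appendDigit b xs ≡ (a + b + 1) * 10 ^ length xs
foldl-tensComplement a b {x ∷ []} _ (x≤9 ∷ []) = begin
  10 * a + (10 ∸ x) + (10 * b + x)  ≡⟨ appendDigit-∸ a b (m≤n⇒m≤1+n x≤9) ⟩
  10 * (a + b) + 10                 ≡⟨ ten-carry (a + b) ⟩
  (a + b + 1) * 10                  ∎
  where
  open ≡-Reasoning
  ten-carry : ∀ c → 10 * c + 10 ≡ (c + 1) * 10
  ten-carry = solve-∀
foldl-tensComplement a b {x ∷ y ∷ ys} _ (x≤9 ∷ ys≤9) = begin
  foldl appendDigit (10 * a + (9 ∸ x)) (tensComplement (y ∷ ys)) + foldl appendDigit (10 * b + x) (y ∷ ys)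
    ≡⟨ foldl-tensComplement _ _ (s≤s z≤n) ys≤9 ⟩
  (10 * a + (9 ∸ x) + (10 * b + x) + 1) * 10 ^ length (y ∷ ys)
    ≡⟨ cong (λ c → (c + 1) * 10 ^ length (y ∷ ys)) (appendDigit-∸ a b x≤9) ⟩
  (10 * (a + b) + 9 + 1) * 10 ^ length (y ∷ ys)
    ≡⟨ nine-carry (a + b) (10 ^ length (y ∷ ys)) ⟩
  (a + b + 1) * 10 ^ length (x ∷ y ∷ ys) ∎
  where open ≡-Reasoning

valueL-kaprekarDigits : ∀ r {αs} → 0 < length αs → All (1 ≤_) αs → All (_≤ 9) αs →
  valueL (kaprekarDigits r αs) + valueL (reverse αs) ≡ valueL αs * 10 ^ r * 10 ^ length αs
valueL-kaprekarDigits r {αs} nonempty positive digits = begin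
  valueL (D ++ N ++ T) + valueL (reverse αs)
    ≡⟨ cong (_+ valueL (reverse αs)) (valueL-++-++ D N T) ⟩
  (valueL D * 10 ^ length N + valueL N) * 10 ^ length T + valueL T + valueL (reverse αs)
    ≡⟨ cong₂ (λ i j → (valueL D * 10 ^ i + valueL N) * 10 ^ j + valueL T + valueL (reverse αs))
         (length-replicate r) (trans (length-tensComplement (reverse αs)) (length-reverse αs)) ⟩
  (valueL D * 10 ^ r + valueL N) * 10 ^ length αs + valueL T + valueL (reverse αs)
    ≡⟨ borrow (foldl-decrementLast 0 nonempty positive)
              (trans (foldl-nines 0 r) (*-identityˡ (10 ^ r)))
              (trans (foldl-tensComplement 0 0 nonempty′ (All-reverse digits))
                     (trans (*-identityˡ _) (cong (10 ^_) (length-reverse αs)))) ⟩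
  valueL αs * 10 ^ r * 10 ^ length αs ∎
  where
  open ≡-Reasoning
  D = decrementLast αs
  N = replicate r 9
  T = tensComplement (reverse αs)
  nonempty′ : 0 < length (reverse αs)
  nonempty′ = subst (0 <_) (sym (length-reverse αs)) nonempty
  collect : ∀ e n t q → (e * (n + 1) + n) * (t + q) + t + q ≡ (e + 1) * (n + 1) * (t + q)
  collect = solve-∀
  borrow : ∀ {e p n R t q H} → e + 1 ≡ p → n + 1 ≡ R → t + q ≡ H → (e * R + n) * H + t + q ≡ p * R * H
  borrow {e} {n = n} {t = t} {q = q} refl refl refl = collect e n t q

decrementLast-digits : ∀ {xs} → All (_≤ 9) xs → All (_< 10) (decrementLast xs)
decrementLast-digits {[]}         []              = []
decrementLast-digits {x ∷ []}     (x≤9 ∷ [])      = s≤s (≤-trans (m∸n≤m x 1) x≤9) ∷ []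
decrementLast-digits {x ∷ y ∷ ys} (x≤9 ∷ ys≤9)    = s≤s x≤9 ∷ decrementLast-digits ys≤9

tensComplement-digits : ∀ {xs} → All (1 ≤_) xs → All (_< 10) (tensComplement xs)
tensComplement-digits {[]}         []         = []
tensComplement-digits {zero ∷ []}  (() ∷ [])
tensComplement-digits {suc x ∷ []} (_ ∷ [])   = s≤s (m∸n≤m 9 x) ∷ []
tensComplement-digits {x ∷ y ∷ ys} (_ ∷ pos)  = s≤s (m∸n≤m 9 x) ∷ tensComplement-digits pos

kaprekarDigits-digits : ∀ r {αs} → All (1 ≤_) αs → All (_≤ 9) αs → All (_< 10) (kaprekarDigits r αs)
kaprekarDigits-digits r positive digits =
  ++⁺ (decrementLast-digits digits) (++⁺ (replicate⁺ r ≤-refl) (tensComplement-digits (All-reverse positive)))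

zipWith-∸-digits : ∀ {xs ys} → All (_< 10) xs → All (_≤ 9) (zipWith _∸_ xs ys)
zipWith-∸-digits {[]}             []            = []
zipWith-∸-digits {x ∷ xs} {[]}    _             = []
zipWith-∸-digits {x ∷ xs} {y ∷ ys} (x<10 ∷ xs<10) = ≤-trans (m∸n≤m x y) (≤-pred x<10) ∷ zipWith-∸-digits xs<10

zipWith-∸-positive⇒< : ∀ {xs ys} → length xs ≡ length ys → All (1 ≤_) (zipWith _∸_ xs ys) → Pointwise _<_ ys xs
zipWith-∸-positive⇒< {[]}     {[]}     _  _        = []
zipWith-∸-positive⇒< {x ∷ xs} {y ∷ ys} eq (p ∷ ps) = m∸n≢0⇒n<m (n>0⇒n≢0 p) ∷ zipWith-∸-positive⇒< (suc-injective eq) ps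

valueL-reverse∸valueL-++ : ∀ L M R → 0 < length L → Pointwise _<_ L (reverse R) → reverse M ≡ M → All (_< 10) R →
  valueL (reverse (L ++ M ++ R)) ∸ valueL (L ++ M ++ R) ≡ valueL (kaprekarDigits (length M) (zipWith _∸_ (reverse R) L))
valueL-reverse∸valueL-++ L M R nonempty L<R̅ palindrome R<10 = begin
  valueL (reverse (L ++ M ++ R)) ∸ valueL (L ++ M ++ R)
    ≡⟨ cong₂ _∸_ upper lower ⟩
  ((vP + vL) * 10 ^ r + vM) * 10 ^ h + vL̅ ∸ ((vL * 10 ^ r + vM) * 10 ^ h + (vP̅ + vL̅))
    ≡⟨ cancel vP vL vM vL̅ vP̅ (10 ^ r) (10 ^ h) ⟩
  vP * 10 ^ r * 10 ^ h ∸ vP̅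
    ≡⟨ cong (λ k → vP * 10 ^ r * 10 ^ k ∸ vP̅) lengthP ⟨
  vP * 10 ^ r * 10 ^ length P ∸ vP̅
    ≡⟨ cong (_∸ vP̅) (valueL-kaprekarDigits r (subst (0 <_) (sym lengthP) nonempty) positiveP digitsP) ⟨
  valueL (kaprekarDigits r P) + vP̅ ∸ vP̅
    ≡⟨ m+n∸n≡m _ vP̅ ⟩
  valueL (kaprekarDigits r P) ∎
  where
  open ≡-Reasoning
  P = zipWith _∸_ (reverse R) L
  r = length M
  h = length L
  vP = valueL P
  vP̅ = valueL (reverse P)
  vL = valueL L
  vL̅ = valueL (reverse L)
  vM = valueL M
  L≤R̅ : Pointwise _≤_ L (reverse R)
  L≤R̅ = Pointwise.map <⇒≤ L<R̅
  lengthR̅ : length (reverse R) ≡ h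
  lengthR̅ = sym (Pointwise-length L<R̅)
  lengthP : length P ≡ h
  lengthP = trans (length-zipWith _∸_ (reverse R) L) (trans (cong (_⊓ h) lengthR̅) (⊓-idem h))
  positiveP : All (1 ≤_) P
  positiveP = zipWith⁺ _∸_ (Pointwise.symmetric m<n⇒0<n∸m L<R̅)
  digitsP : All (_≤ 9) P
  digitsP = zipWith-∸-digits (All-reverse R<10)
  upper : valueL (reverse (L ++ M ++ R)) ≡ ((vP + vL) * 10 ^ r + vM) * 10 ^ h + vL̅
  upper = begin
    valueL (reverse (L ++ M ++ R))
      ≡⟨ cong valueL (reverse-++-++ L M R) ⟩
    valueL (reverse R ++ reverse M ++ reverse L)
      ≡⟨ valueL-++-++ (reverse R) (reverse M) (reverse L) ⟩
    (valueL (reverse R) * 10 ^ length (reverse M) + valueL (reverse M)) * 10 ^ length (reverse L) + vL̅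
      ≡⟨ cong (λ Z → (valueL (reverse R) * 10 ^ length Z + valueL Z) * 10 ^ length (reverse L) + vL̅) palindrome ⟩
    (valueL (reverse R) * 10 ^ r + vM) * 10 ^ length (reverse L) + vL̅
      ≡⟨ cong₂ (λ u k → (u * 10 ^ r + vM) * 10 ^ k + vL̅) (sym (valueL-zipWith-∸ L≤R̅)) (length-reverse L) ⟩
    ((vP + vL) * 10 ^ r + vM) * 10 ^ h + vL̅ ∎
  lower : valueL (L ++ M ++ R) ≡ (vL * 10 ^ r + vM) * 10 ^ h + (vP̅ + vL̅)
  lower = begin
    valueL (L ++ M ++ R)
      ≡⟨ valueL-++-++ L M R ⟩
    (vL * 10 ^ r + vM) * 10 ^ length R + valueL R
      ≡⟨ cong₂ (λ k u → (vL * 10 ^ r + vM) * 10 ^ k + u)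
           (trans (sym (length-reverse R)) lengthR̅)
           (sym (trans (valueL-reverse-zipWith-∸ L≤R̅) (cong valueL (reverse-involutive R)))) ⟩
    (vL * 10 ^ r + vM) * 10 ^ h + (vP̅ + vL̅) ∎
  cancel : ∀ p l m t q x y → ((p + l) * x + m) * y + t ∸ ((l * x + m) * y + (q + t)) ≡ p * x * y ∸ q
  cancel p l m t q x y =
    trans (cong₂ _∸_ (regroup₁ p l m t x y) (regroup₂ l m t q x y)) ([m+n]∸[m+o]≡n∸o ((l * x + m) * y + t) (p * x * y) q)
    where
    regroup₁ : ∀ p l m t x y → ((p + l) * x + m) * y + t ≡ (l * x + m) * y + t + p * x * y
    regroup₁ = solve-∀
    regroup₂ : ∀ l m t q x y → (l * x + m) * y + (q + t) ≡ (l * x + m) * y + t + q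
    regroup₂ = solve-∀

valueL-reverse∸valueL : ∀ h r xs → 0 < h → r ≤ 1 → length xs ≡ h + (r + h) → All (_< 10) xs →
  All (1 ≤_) (zipWith _∸_ (take h (reverse xs)) (take h xs)) →
  valueL (reverse xs) ∸ valueL xs ≡ valueL (kaprekarDigits r (zipWith _∸_ (take h (reverse xs)) (take h xs)))
valueL-reverse∸valueL h r xs 0<h r≤1 length-xs xs<10 positive with splitAt-length h xs length-xs
... | L , MR , refl , refl , length-MR with splitAt-length r MR length-MR
... | M , R , refl , refl , length-R = begin
  valueL (reverse (L ++ M ++ R)) ∸ valueL (L ++ M ++ R)
    ≡⟨ valueL-reverse∸valueL-++ L M R 0<h L<R̅ (reverse-length≤1 M r≤1) R<10 ⟩
  valueL (kaprekarDigits (length M) (zipWith _∸_ (reverse R) L))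
    ≡⟨ cong (valueL ∘ kaprekarDigits (length M)) halves ⟨
  valueL (kaprekarDigits (length M) (zipWith _∸_ (take (length L) (reverse (L ++ M ++ R))) (take (length L) (L ++ M ++ R)))) ∎
  where
  open ≡-Reasoning
  length-R̅ : length (reverse R) ≡ length L
  length-R̅ = trans (length-reverse R) length-R
  halves : zipWith _∸_ (take (length L) (reverse (L ++ M ++ R))) (take (length L) (L ++ M ++ R)) ≡ zipWith _∸_ (reverse R) L
  halves = cong₂ (zipWith _∸_)
    (trans (cong (take (length L)) (reverse-++-++ L M R)) (take-++-length (reverse R) _ length-R̅))
    (take-++-length L (M ++ R) refl)
  L<R̅ : Pointwise _<_ L (reverse R)
  L<R̅ = zipWith-∸-positive⇒< length-R̅ (subst (All (1 ≤_)) halves positive)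
  R<10 : All (_< 10) R
  R<10 = proj₂ (++⁻ M (proj₂ (++⁻ L xs<10)))

⌈n/2⌉∸⌊n/2⌋≤1 : ∀ n → ⌈ n /2⌉ ∸ ⌊ n /2⌋ ≤ 1
⌈n/2⌉∸⌊n/2⌋≤1 zero          = z≤n
⌈n/2⌉∸⌊n/2⌋≤1 (suc zero)    = ≤-refl
⌈n/2⌉∸⌊n/2⌋≤1 (suc (suc n)) = ⌈n/2⌉∸⌊n/2⌋≤1 n

⌊n/2⌋+[⌈n/2⌉∸⌊n/2⌋+⌊n/2⌋]≡n : ∀ n → ⌊ n /2⌋ + (⌈ n /2⌉ ∸ ⌊ n /2⌋ + ⌊ n /2⌋) ≡ n
⌊n/2⌋+[⌈n/2⌉∸⌊n/2⌋+⌊n/2⌋]≡n n = trans (cong (⌊ n /2⌋ +_) (m∸n+n≡m (⌊n/2⌋≤⌈n/2⌉ n))) (⌊n/2⌋+⌈n/2⌉≡n n)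

length-sortedUp : ∀ {w} (d : Digits w) → length (sortedUp d) ≡ w
length-sortedUp d = trans (↭-length (sort-↭ (digitsℕ d))) (trans (length-map toℕ (toList d)) (length-toList d))

sortedUp-digits : ∀ {w} (d : Digits w) → All (_< 10) (sortedUp d)
sortedUp-digits d = All-resp-↭ (↭-sym (sort-↭ (digitsℕ d))) (map⁺ (universal toℕ<n (toList d)))

params-digits : ∀ {w} (d : Digits w) → All (_≤ 9) (params d)
params-digits {w} d = zipWith-∸-digits (take⁺ ⌊ w /2⌋ (All-reverse (sortedUp-digits d)))

length-params : ∀ {w} (d : Digits w) → length (params d) ≡ ⌊ w /2⌋
length-params {w} d = begin
  length (zipWith _∸_ (take h (reverse xs)) (take h xs))   ≡⟨ length-zipWith _∸_ (take h (reverse xs)) (take h xs) ⟩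
  length (take h (reverse xs)) ⊓ length (take h xs)       ≡⟨ cong₂ _⊓_ (trans (length-take h (reverse xs)) (trans (cong (h ⊓_) (length-reverse xs)) h⊓w≡h))
                                                                        (trans (length-take h xs) h⊓w≡h) ⟩
  h ⊓ h                                                    ≡⟨ ⊓-idem h ⟩
  h                                                        ∎
  where
  open ≡-Reasoning
  h = ⌊ w /2⌋
  xs = sortedUp d
  h⊓w≡h : h ⊓ length xs ≡ h
  h⊓w≡h = trans (cong (h ⊓_) (length-sortedUp d)) (m≤n⇒m⊓n≡m (⌊n/2⌋≤n w))

digitsℕ-K : ∀ {w} (d : Digits w) → 2 ≤ w → All (1 ≤_) (params d) →
  digitsℕ (K d) ≡ kaprekarDigits (⌈ w /2⌉ ∸ ⌊ w /2⌋) (params d)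
digitsℕ-K {w} d 2≤w positive = begin
  digitsℕ (toDigits w (valueL (reverse xs) ∸ valueL xs))
    ≡⟨ cong (digitsℕ ∘ toDigits w)
         (valueL-reverse∸valueL h r xs (⌊n/2⌋-mono 2≤w) (⌈n/2⌉∸⌊n/2⌋≤1 w)
           (trans (length-sortedUp d) (sym (⌊n/2⌋+[⌈n/2⌉∸⌊n/2⌋+⌊n/2⌋]≡n w))) (sortedUp-digits d) positive) ⟩
  digitsℕ (toDigits w (valueL (kaprekarDigits r (params d))))
    ≡⟨ toDigits-valueL (kaprekarDigits r (params d)) length-K (kaprekarDigits-digits r positive (params-digits d)) ⟩
  kaprekarDigits r (params d) ∎
  where
  open ≡-Reasoning
  h = ⌊ w /2⌋
  r = ⌈ w /2⌉ ∸ ⌊ w /2⌋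
  xs = sortedUp d
  length-K : length (kaprekarDigits r (params d)) ≡ w
  length-K = trans (length-kaprekarDigits r (params d))
    (trans (cong (λ k → k + (r + k)) (length-params d)) (⌊n/2⌋+[⌈n/2⌉∸⌊n/2⌋+⌊n/2⌋]≡n w))

K-resp-↭ : ∀ {w} (d e : Digits w) → digitsℕ d ↭ digitsℕ e → K d ≡ K e
K-resp-↭ {w} d e d↭e = cong (λ xs → toDigits w (valueL (reverse xs) ∸ valueL xs)) sortedUp-d≡sortedUp-e
  where
  sortedUp-d≡sortedUp-e : sortedUp d ≡ sortedUp e
  sortedUp-d≡sortedUp-e = Pointwise-≡⇒≡ (↗↭↗⇒≋ ≤-totalOrder (sort-↗ (digitsℕ d)) (sort-↗ (digitsℕ e))
    (↭⇒↭ₛ (↭-trans (sort-↭ (digitsℕ d)) (↭-trans d↭e (↭-sym (sort-↭ (digitsℕ e)))))))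

kaprekarDigits-last-two : ∀ r αs a b →
  kaprekarDigits r (αs ++ a ∷ b ∷ []) ≡ αs ++ a ∷ (b ∸ 1) ∷ replicate r 9 ++ (9 ∸ b) ∷ tensComplement (a ∷ reverse αs)
kaprekarDigits-last-two r αs a b = begin
  decrementLast (αs ++ a ∷ b ∷ []) ++ replicate r 9 ++ tensComplement (reverse (αs ++ a ∷ b ∷ []))
    ≡⟨ cong₂ (λ u v → u ++ replicate r 9 ++ v) (decrementLast-++ αs a (b ∷ [])) (cong tensComplement (reverse-++ αs (a ∷ b ∷ []))) ⟩
  (αs ++ a ∷ (b ∸ 1) ∷ []) ++ replicate r 9 ++ (9 ∸ b) ∷ tensComplement (a ∷ reverse αs)
    ≡⟨ ++-assoc αs (a ∷ (b ∸ 1) ∷ []) _ ⟩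
  αs ++ a ∷ (b ∸ 1) ∷ replicate r 9 ++ (9 ∸ b) ∷ tensComplement (a ∷ reverse αs) ∎
  where open ≡-Reasoning

kaprekarDigits-complementLast-↭ : ∀ r αs a {b} → b ≤ 9 →
  kaprekarDigits r (αs ++ a ∷ b ∷ []) ↭ kaprekarDigits r (αs ++ a ∷ (10 ∸ b) ∷ [])
kaprekarDigits-complementLast-↭ r αs a {b} b≤9 = begin
  kaprekarDigits r (αs ++ a ∷ b ∷ [])
    ≡⟨ kaprekarDigits-last-two r αs a b ⟩
  αs ++ a ∷ (b ∸ 1) ∷ N ++ (9 ∸ b) ∷ T
    ↭⟨ ++⁺ˡ αs (prep a (↭-exchange (b ∸ 1) (9 ∸ b) N T)) ⟩
  αs ++ a ∷ (9 ∸ b) ∷ N ++ (b ∸ 1) ∷ T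
    ≡⟨ cong₂ (λ u v → αs ++ a ∷ u ∷ N ++ v ∷ T) 10∸b∸1≡9∸b (9∸[10∸b]≡b∸1 b≤9) ⟨
  αs ++ a ∷ (10 ∸ b ∸ 1) ∷ N ++ (9 ∸ (10 ∸ b)) ∷ T
    ≡⟨ kaprekarDigits-last-two r αs a (10 ∸ b) ⟨
  kaprekarDigits r (αs ++ a ∷ (10 ∸ b) ∷ []) ∎
  where
  open PermutationReasoning
  N = replicate r 9
  T = tensComplement (a ∷ reverse αs)
  10∸b∸1≡9∸b : 10 ∸ b ∸ 1 ≡ 9 ∸ b
  10∸b∸1≡9∸b = trans (∸-+-assoc 10 b 1) (cong (10 ∸_) (+-comm b 1))
  9∸[10∸b]≡b∸1 : ∀ {x} → x ≤ 9 → 9 ∸ (10 ∸ x) ≡ x ∸ 1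
  9∸[10∸b]≡b∸1 {zero}  _         = refl
  9∸[10∸b]≡b∸1 {suc c} (s≤s c≤8) = m∸[m∸n]≡n (m≤n⇒m≤1+n c≤8)

mainTheorem12 : (w : ℕ) → 4 ≤ w → (m n : Digits w) → InA m → InA n →
    (αs : List ℕ) (a b : ℕ) →
    params m ≡ αs ++ (a ∷ b ∷ []) →
    All (1 ≤_) (params m) →
    10 ≤ a + b →
    params n ≡ αs ++ (a ∷ (10 ∸ b) ∷ []) →
    K² m ≡ K² n
mainTheorem12 w 4≤w m n _ _ αs a b params-m positive-m _ params-n = K-resp-↭ (K m) (K n) (begin
  digitsℕ (K m)                               ≡⟨ digitsℕ-K m 2≤w positive-m ⟩
  kaprekarDigits r (params m)                 ≡⟨ cong (kaprekarDigits r) params-m ⟩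
  kaprekarDigits r (αs ++ a ∷ b ∷ [])         ↭⟨ kaprekarDigits-complementLast-↭ r αs a b≤9 ⟩
  kaprekarDigits r (αs ++ a ∷ (10 ∸ b) ∷ [])  ≡⟨ cong (kaprekarDigits r) params-n ⟨
  kaprekarDigits r (params n)                 ≡⟨ digitsℕ-K n 2≤w positive-n ⟨
  digitsℕ (K n)                               ∎)
  where
  open PermutationReasoning
  r = ⌈ w /2⌉ ∸ ⌊ w /2⌋
  2≤w : 2 ≤ w
  2≤w = ≤-trans (s≤s (s≤s z≤n)) 4≤w
  b≤9 : b ≤ 9
  b≤9 with ++⁻ αs (subst (All (_≤ 9)) params-m (params-digits m))
  ... | _ , _ ∷ b≤9 ∷ [] = b≤9
  positive-n : All (1 ≤_) (params n)
  positive-n with ++⁻ αs (subst (All (1 ≤_)) params-m positive-m)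
  ... | αs-positive , a-positive ∷ _ =
    subst (All (1 ≤_)) (sym params-n) (++⁺ αs-positive (a-positive ∷ m<n⇒0<n∸m (s≤s b≤9) ∷ []))
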